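{- Let $\lambda,\lambda_1$ be functions from $\mathfrak U$ to $\mathbb N$ and $k\ge1$ with $|\mathcal U|>\lambda_1\ge\lambda^k$, and let $R$ be a $k$-place relation on a set $A\subseteq\mathcal U$ with $|A|\le\lambda$. Then $Q_R\le_{\mathrm{exp}}Q^{1-1}_{\lambda_1}$.
   Context: Setting: $\mathfrak U$ is a fixed family of finite sets (universes) $\mathcal U$; relations and numerical parameters are functions on $\mathfrak U$, and (in)equalities hold for each $\mathcal U$. $Q_R$ is the second-order quantifier ranging over all $R'$ with $(\mathcal U,R')\cong(\mathcal U,R)$. $Q^{1-1}_\mu$ is the second-order quantifier ranging over graphs of partial one-to-one functions from $\mathcal U$ to $\mathcal U$ whose domain has exactly $\mu(\mathcal U)$ elements. $Q_R\le_{\mathrm{exp}}Q^{1-1}_{\lambda_1}$ (expressibility) means there is a formula $\varphi(\bar x,S_0,\dots,S_{m-1})$ of first-order logic extended by the quantifier $Q^{1-1}_{\lambda_1}$, the same for all $\mathcal U$, such that for each $\mathcal U$ and each $R'$ in the range of $Q_R$ there are $S_0,\dots,S_{m-1}$ in the range of $Q^{1-1}_{\lambda_1}$ with $R'=\{\bar a:(\mathcal U,\bar S)\models\varphi(\bar a,\bar S)\}$. -}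

module Defs where

open import Data.Nat using (ℕ; zero; suc; _+_)
open import Data.Bool using (Bool; true; false; _∨_)
open import Data.Fin using (Fin; zero; suc)
open import Data.Vec using (Vec; []; _∷_; map; lookup)
open import Data.Product using (Σ; _×_)
open import Data.Empty using (⊥)
open import Function.Bundles using (_↔_; Inverse)
open import Relation.Binary.PropositionalEquality using (_≡_)
open import Function.Bundles using (_⇔_)

-- A universe of size n is modelled as Fin n.
-- Binary relations on the universe (Bool-valued, since universes are finite).
Rel₂ : ℕ → Set
Rel₂ n = Fin n → Fin n → Bool

RelK : ℕ → ℕ → Set
RelK n k = Vec (Fin n) k → Bool

countB : (n : ℕ) → (Fin n → Bool) → ℕ
countB zero    p = 0
countB (suc n) p with p zero
... | true  = suc (countB n (λ x → p (suc x)))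
... | false = countB n (λ x → p (suc x))

anyB : (n : ℕ) → (Fin n → Bool) → Bool
anyB zero    p = false
anyB (suc n) p = p zero ∨ anyB n (λ x → p (suc x))

-- S is the graph of a partial one-to-one function U → U whose domain has exactly L elements
-- (the range of the quantifier Q^{1-1}_L).
IsPartialInjOfSize : (n L : ℕ) → Rel₂ n → Set
IsPartialInjOfSize n L S =
  (∀ a b b′ → S a b ≡ true → S a b′ ≡ true → b ≡ b′) ×
  (∀ a a′ b → S a b ≡ true → S a′ b ≡ true → a ≡ a′) ×
  (countB n (λ a → anyB n (λ b → S a b)) ≡ L)

-- Formulas of first-order logic (language: = and binary relation variables)
-- extended by the second-order quantifier Q^{1-1}.
-- v = number of free first-order variables, r = number of free binary relation variables.
data Formula (v r : ℕ) : Set where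
  eq   : Fin v → Fin v → Formula v r
  rel  : Fin r → Fin v → Fin v → Formula v r
  neg  : Formula v r → Formula v r
  conj : Formula v r → Formula v r → Formula v r
  ex   : Formula (suc v) r → Formula v r          -- first-order ∃ (binds variable zero)
  q11  : Formula v (suc r) → Formula v r          -- Q^{1-1}_λ₁ S (binds relation variable zero)

extend : {A : Set} {m : ℕ} → A → (Fin m → A) → Fin (suc m) → A
extend a ρ zero    = a
extend a ρ (suc x) = ρ x

-- Satisfaction in the universe Fin n where the quantifier Q^{1-1} has parameter L = λ₁(U).
Sat : (n L : ℕ) {v r : ℕ} → Formula v r → (Fin v → Fin n) → (Fin r → Rel₂ n) → Set
Sat n L (eq x y)    ρ σ = ρ x ≡ ρ y
Sat n L (rel j x y) ρ σ = σ j (ρ x) (ρ y) ≡ true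
Sat n L (neg φ)     ρ σ = Sat n L φ ρ σ → ⊥
Sat n L (conj φ ψ)  ρ σ = Sat n L φ ρ σ × Sat n L ψ ρ σ
Sat n L (ex φ)      ρ σ = Σ (Fin n) (λ a → Sat n L φ (extend a ρ) σ)
Sat n L (q11 φ)     ρ σ = Σ (Rel₂ n) (λ S → IsPartialInjOfSize n L S × Sat n L φ ρ (extend S σ))

-- (U, R′) ≅ (U, R): R′ is in the range of the quantifier Q_R.
IsoRel : (n k : ℕ) → RelK n k → RelK n k → Set
IsoRel n k R′ R = Σ (Fin n ↔ Fin n) (λ π → ∀ (v : Vec (Fin n) k) → R′ (map (Inverse.to π) v) ≡ R v)

-- Q_R ≤_exp Q^{1-1}_{λ₁} over the family of universes indexed by I (universe i is Fin (N i)).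
ExpressibleQ11 : (I : Set) (N : I → ℕ) (λ₁ : I → ℕ) (k : ℕ) → ((i : I) → RelK (N i) k) → Set
ExpressibleQ11 I N λ₁ k R =
  Σ ℕ (λ m → Σ (Formula k m) (λ φ →
    ∀ (i : I) (R′ : RelK (N i) k) → IsoRel (N i) k R′ (R i) →
      Σ (Fin m → Rel₂ (N i)) (λ S →
        (∀ j → IsPartialInjOfSize (N i) (λ₁ i) (S j)) ×
        (∀ (v : Vec (Fin (N i)) k) → (R′ v ≡ true) ⇔ Sat (N i) (λ₁ i) φ (lookup v) S))))

-- Permuting the universe moves A onto [0, s), s = |A|, and satisfaction is invariant under
-- permutations; so a k-tuple over A becomes a code c < s^k ≤ λ₁, written in base s. Every relation
-- needed is then the graph of a partial injection with domain [0, λ₁) (the point λ₁ < |U| is spare):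
-- one fixing exactly the codes of R-tuples, one fixing exactly the digits, for each j one exchanging
-- digits 0 and j of a code, and `shift`, which cycles every column {x + s q} of codes with low digit x.
-- "d has low digit x" is then expressed with Q^{1-1}: a partial injection T with domain [0, λ₁) whose
-- edges are shift-edges or loops and which loops at x must loop on the whole cycle of x, whereas for
-- d off that cycle such a T is obtained by fixing the column of x and following shift elsewhere.

module Submission where

open import Defs
open import Data.Nat using (ℕ; zero; suc; pred; >-nonZero; _+_; _*_; _^_; _∸_; _≤_; _<_; _>_; z≤n; s≤s; _<ᵇ_; _≡ᵇ_)
open import Data.Nat.DivMod
  using (_%_; _/_; m≡m%n+[m/n]*n; [m+kn]%n≡m%n; m<n⇒m%n≡m; m<n⇒m/n≡0; m*n/n≡m; +-distrib-/-∣ʳ; m%n<n; m<n*o⇒m/o<n)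
open import Data.Nat.Divisibility using (divides)
open import Data.Nat.Properties
open import Data.Bool using (Bool; true; false; _∧_; _∨_; T; if_then_else_)
open import Data.Bool.Properties using (T-≡; ∨-zeroʳ)
open import Data.Fin using (Fin; zero; suc; toℕ; fromℕ<; punchIn)
open import Data.Fin.Properties using (toℕ-injective; toℕ-fromℕ<; toℕ<n) renaming (_≟_ to _≟ᶠ_)
open import Data.Fin.Permutation
  using (Permutation′; _⟨$⟩ʳ_; _⟨$⟩ˡ_; _∘ₚ_; id; flip; lift₀; insert; remove; punchIn-permute; insert-punchIn)
open import Data.Fin.Subset using (Subset; ∣_∣; _∈_)
open import Data.Fin.Subset.Properties using (∣p∣≤n; x∈p⇒∣p-x∣<∣p∣)
open import Data.Vec using (Vec; _∷_; []; lookup; tabulate; map)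
open import Data.Vec.Properties using (tabulate-cong; tabulate∘lookup; lookup-map; map-∘; map-cong; map-id)
open import Data.Vec.Relation.Unary.All using (All)
open import Data.Vec.Relation.Unary.All.Properties using (lookup⁺)
open import Data.Vec.Base using (here; there)
open import Data.Product using (Σ; _×_; _,_; proj₁; proj₂)
open import Data.Sum using (_⊎_; inj₁; inj₂; [_,_])
open import Data.Empty using (⊥-elim)
open import Function using (_∘_)
open import Function.Bundles using (_⇔_; mk⇔; Equivalence; Inverse; Injection)
open import Function.Properties.Inverse using (↔⇒↣)
open import Function.Properties.Equivalence using () renaming (trans to ⇔-trans; sym to ⇔-sym)
open import Relation.Binary.PropositionalEquality using (_≡_; _≢_; refl; sym; trans; cong; cong₂; subst; module ≡-Reasoning)
open import Relation.Nullary using (¬_; yes; no; contradiction)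
open import Relation.Binary.Definitions using (tri<; tri≈; tri>)

false≢true : false ≢ true
false≢true ()

private
  ≡true⇒T : ∀ {b} → b ≡ true → T b
  ≡true⇒T = Equivalence.from T-≡

  T⇒≡true : ∀ {b} → T b → b ≡ true
  T⇒≡true = Equivalence.to T-≡

<⇒<ᵇ≡true : ∀ {m n} → m < n → (m <ᵇ n) ≡ true
<⇒<ᵇ≡true m<n = T⇒≡true (<⇒<ᵇ m<n)

<ᵇ≡true⇒< : ∀ {m n} → (m <ᵇ n) ≡ true → m < n
<ᵇ≡true⇒< {m} {n} e = <ᵇ⇒< m n (≡true⇒T e)

≡⇒≡ᵇ≡true : ∀ {m n} → m ≡ n → (m ≡ᵇ n) ≡ true
≡⇒≡ᵇ≡true {m} {n} e = T⇒≡true (≡⇒≡ᵇ m n e)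

≡ᵇ≡true⇒≡ : ∀ {m n} → (m ≡ᵇ n) ≡ true → m ≡ n
≡ᵇ≡true⇒≡ {m} {n} e = ≡ᵇ⇒≡ m n (≡true⇒T e)

∧≡true⇒× : ∀ {a b} → (a ∧ b) ≡ true → a ≡ true × b ≡ true
∧≡true⇒× {true} e = refl , e

×⇒∧≡true : ∀ {a b} → a ≡ true → b ≡ true → (a ∧ b) ≡ true
×⇒∧≡true refl refl = refl

indicator : Bool → ℕ
indicator true  = 1
indicator false = 0

countB-suc : ∀ {n} (p : Fin (suc n) → Bool) → countB (suc n) p ≡ indicator (p zero) + countB n (λ x → p (suc x))
countB-suc p with p zero
... | true  = refl
... | false = refl

countB-cong : ∀ {n} {p q : Fin n → Bool} → (∀ a → p a ≡ q a) → countB n p ≡ countB n q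
countB-cong {zero}  p≗q = refl
countB-cong {suc n} {p} {q} p≗q = begin
  countB (suc n) p                                       ≡⟨ countB-suc p ⟩
  indicator (p zero) + countB n (λ x → p (suc x))        ≡⟨ cong₂ _+_ (cong indicator (p≗q zero)) (countB-cong (λ x → p≗q (suc x))) ⟩
  indicator (q zero) + countB n (λ x → q (suc x))        ≡⟨ countB-suc q ⟨
  countB (suc n) q                                       ∎
  where open ≡-Reasoning

countB-punchIn : ∀ {n} (p : Fin (suc n) → Bool) (i : Fin (suc n)) →
                 countB (suc n) p ≡ indicator (p i) + countB n (λ x → p (punchIn i x))
countB-punchIn p zero = countB-suc p
countB-punchIn {suc n} p (suc i) = begin
  countB (suc (suc n)) p                                           ≡⟨ countB-suc p ⟩
  indicator (p zero) + countB (suc n) (λ x → p (suc x))            ≡⟨ cong (indicator (p zero) +_) (countB-punchIn (λ x → p (suc x)) i) ⟩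
  indicator (p zero) + (indicator (p (suc i)) + rest)              ≡⟨ +-assoc (indicator (p zero)) _ _ ⟨
  indicator (p zero) + indicator (p (suc i)) + rest                ≡⟨ cong (_+ rest) (+-comm (indicator (p zero)) _) ⟩
  indicator (p (suc i)) + indicator (p zero) + rest                ≡⟨ +-assoc (indicator (p (suc i))) _ _ ⟩
  indicator (p (suc i)) + (indicator (p zero) + rest)              ≡⟨ cong (indicator (p (suc i)) +_) (countB-suc (λ x → p (punchIn (suc i) x))) ⟨
  indicator (p (suc i)) + countB (suc n) (λ x → p (punchIn (suc i) x)) ∎
  where
    open ≡-Reasoning
    rest : ℕ
    rest = countB n (λ x → p (suc (punchIn i x)))

countB-permute : ∀ {n} (π : Permutation′ n) (p : Fin n → Bool) → countB n (λ x → p (π ⟨$⟩ʳ x)) ≡ countB n p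
countB-permute {zero}  π p = refl
countB-permute {suc n} π p = begin
  countB (suc n) (λ x → p (π ⟨$⟩ʳ x))                                    ≡⟨ countB-suc (λ x → p (π ⟨$⟩ʳ x)) ⟩
  indicator (p i) + countB n (λ x → p (π ⟨$⟩ʳ suc x))                     ≡⟨ cong (indicator (p i) +_) (countB-cong (λ x → cong p (punchIn-permute π zero x))) ⟩
  indicator (p i) + countB n (λ x → p (punchIn i (remove zero π ⟨$⟩ʳ x))) ≡⟨ cong (indicator (p i) +_) (countB-permute (remove zero π) (λ y → p (punchIn i y))) ⟩
  indicator (p i) + countB n (λ y → p (punchIn i y))                      ≡⟨ countB-punchIn p i ⟨
  countB (suc n) p                                                        ∎
  where
    open ≡-Reasoning
    i : Fin (suc n)
    i = π ⟨$⟩ʳ zero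

countB-mono : ∀ {n} {p q : Fin n → Bool} → (∀ a → p a ≡ true → q a ≡ true) → countB n p ≤ countB n q
countB-mono {zero} p⊆q = z≤n
countB-mono {suc n} {p} {q} p⊆q with p zero in pz | q zero in qz
... | true  | true  = s≤s (countB-mono (λ a → p⊆q (suc a)))
... | false | false = countB-mono (λ a → p⊆q (suc a))
... | false | true  = ≤-trans (countB-mono (λ a → p⊆q (suc a))) (n≤1+n _)
... | true  | false = contradiction (trans (sym qz) (p⊆q zero pz)) false≢true

-- a point of q outside p would make p strictly smaller than q
countB-⊆-≡⇒⊇ : ∀ {n} {p q : Fin n → Bool} → (∀ a → p a ≡ true → q a ≡ true) → countB n p ≡ countB n q →
               ∀ a → q a ≡ true → p a ≡ true
countB-⊆-≡⇒⊇ {suc n} {p} {q} p⊆q #p≡#q a qa with p a in pa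
... | true  = refl
... | false = contradiction #p≡#q (<⇒≢ (begin-strict
  countB (suc n) p                                        ≡⟨ countB-punchIn p a ⟩
  indicator (p a) + countB n (λ x → p (punchIn a x))      ≡⟨ cong (λ b → indicator b + countB n (λ x → p (punchIn a x))) pa ⟩
  countB n (λ x → p (punchIn a x))                        ≤⟨ countB-mono (λ x → p⊆q (punchIn a x)) ⟩
  countB n (λ x → q (punchIn a x))                        <⟨ ≤-refl ⟩
  suc (countB n (λ x → q (punchIn a x)))                  ≡⟨ cong (λ b → indicator b + countB n (λ x → q (punchIn a x))) qa ⟨
  indicator (q a) + countB n (λ x → q (punchIn a x))      ≡⟨ countB-punchIn q a ⟨
  countB (suc n) q                                        ∎))
  where open ≤-Reasoning

countB-<ᵇ : ∀ {n L} → L ≤ n → countB n (λ a → toℕ a <ᵇ L) ≡ L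
countB-<ᵇ {zero}  z≤n     = refl
countB-<ᵇ {suc n} {zero} z≤n = countB-<ᵇ {n} {zero} z≤n
countB-<ᵇ {suc n} {suc L} (s≤s L≤n) = cong suc (countB-<ᵇ L≤n)

anyB⇒∃ : ∀ {n} {p : Fin n → Bool} → anyB n p ≡ true → Σ (Fin n) (λ b → p b ≡ true)
anyB⇒∃ {suc n} {p} e with p zero in pz
... | true  = zero , pz
... | false with anyB⇒∃ e
...   | b , pb = suc b , pb

∃⇒anyB : ∀ {n} {p : Fin n → Bool} (b : Fin n) → p b ≡ true → anyB n p ≡ true
∃⇒anyB {suc n} zero pb rewrite pb = refl
∃⇒anyB {suc n} {p} (suc b) pb rewrite ∃⇒anyB {p = λ x → p (suc x)} b pb = ∨-zeroʳ (p zero)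

∄⇒anyB≡false : ∀ {n} {p : Fin n → Bool} → (∀ b → p b ≢ true) → anyB n p ≡ false
∄⇒anyB≡false {n} {p} ∄ with anyB n p in e
... | false = refl
... | true  = ⊥-elim (∄ _ (proj₂ (anyB⇒∃ {n} {p} e)))

anyB-cong : ∀ {n} {p q : Fin n → Bool} → (∀ a → p a ≡ q a) → anyB n p ≡ anyB n q
anyB-cong {zero}  p≗q = refl
anyB-cong {suc n} p≗q = cong₂ _∨_ (p≗q zero) (anyB-cong (λ a → p≗q (suc a)))

anyB-permute : ∀ {n} (π : Permutation′ n) (p : Fin n → Bool) → anyB n (λ x → p (π ⟨$⟩ʳ x)) ≡ anyB n p
anyB-permute {n} π p with anyB n p in e | anyB n (λ x → p (π ⟨$⟩ʳ x)) in e′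
... | true  | true  = refl
... | false | false = refl
... | true  | false = let b , pb = anyB⇒∃ {n} {p} e in
  trans (sym e′) (∃⇒anyB (π ⟨$⟩ˡ b) (trans (cong p (Inverse.strictlyInverseˡ π b)) pb))
... | false | true  = let b , pb = anyB⇒∃ {n} {λ x → p (π ⟨$⟩ʳ x)} e′ in
  trans (sym (∃⇒anyB (π ⟨$⟩ʳ b) pb)) e

InjectiveOn : ℕ → (ℕ → ℕ) → Set
InjectiveOn L f = ∀ {a a′} → a < L → a′ < L → f a ≡ f a′ → a ≡ a′

MapsInto : ℕ → ℕ → (ℕ → ℕ) → Set
MapsInto L n f = ∀ {a} → a < L → f a < n

-- opaque, so that unification sees `graph` rather than its Boolean unfolding
opaque
  graph : (n L : ℕ) → (ℕ → ℕ) → Rel₂ n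
  graph n L f a b = (toℕ a <ᵇ L) ∧ (toℕ b ≡ᵇ f (toℕ a))

  graph⇒ : ∀ {n L f} {a b : Fin n} → graph n L f a b ≡ true → toℕ a < L × toℕ b ≡ f (toℕ a)
  graph⇒ e = let a<L , b≡fa = ∧≡true⇒× e in <ᵇ≡true⇒< a<L , ≡ᵇ≡true⇒≡ b≡fa

  ⇒graph : ∀ {n L f} {a b : Fin n} → toℕ a < L → toℕ b ≡ f (toℕ a) → graph n L f a b ≡ true
  ⇒graph a<L b≡fa = ×⇒∧≡true (<⇒<ᵇ≡true a<L) (≡⇒≡ᵇ≡true b≡fa)

  graph-domain : ∀ {n L f} → MapsInto L n f → (a : Fin n) → anyB n (graph n L f a) ≡ (toℕ a <ᵇ L)
  graph-domain {n} {L} {f} f-into a with toℕ a <ᵇ L in a<ᵇL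
  ... | true  = let fa<n = f-into (<ᵇ≡true⇒< a<ᵇL) in
                ∃⇒anyB (fromℕ< fa<n) (≡⇒≡ᵇ≡true (toℕ-fromℕ< fa<n))
  ... | false = ∄⇒anyB≡false {n} λ _ ()

module _ {n L : ℕ} {f : ℕ → ℕ} (f-into : MapsInto L n f) where

  graph-isPartialInjOfSize : L ≤ n → InjectiveOn L f → IsPartialInjOfSize n L (graph n L f)
  graph-isPartialInjOfSize L≤n f-inj =
      (λ a b b′ ab ab′ → toℕ-injective (trans (proj₂ (graph⇒ ab)) (sym (proj₂ (graph⇒ ab′)))))
    , (λ a a′ b ab a′b → let a<L , b≡fa = graph⇒ ab ; a′<L , b≡fa′ = graph⇒ a′b in
                         toℕ-injective (f-inj a<L a′<L (trans (sym b≡fa) b≡fa′)))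
    , trans (countB-cong (graph-domain f-into)) (countB-<ᵇ L≤n)

module _ (m : ℕ) (f : ℕ → ℕ) where

  extendById : ℕ → ℕ
  extendById c = if c <ᵇ m then f c else c

  extendById-< : ∀ {c} → c < m → extendById c ≡ f c
  extendById-< c<m rewrite <⇒<ᵇ≡true c<m = refl

  extendById-≮ : ∀ {c} → ¬ c < m → extendById c ≡ c
  extendById-≮ {c} c≮m with c <ᵇ m in c<ᵇm
  ... | true  = contradiction (<ᵇ≡true⇒< c<ᵇm) c≮m
  ... | false = refl

  module _ (f-into : MapsInto m m f) (f-inj : InjectiveOn m f) where

    extendById-into : ∀ {L} → m ≤ L → MapsInto L L extendById
    extendById-into {L} m≤L {a} a<L with a <? m
    ... | yes a<m = subst (_< L) (sym (extendById-< a<m)) (<-≤-trans (f-into a<m) m≤L)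
    ... | no  a≮m = subst (_< L) (sym (extendById-≮ a≮m)) a<L

    extendById-injective : ∀ {a a′} → extendById a ≡ extendById a′ → a ≡ a′
    extendById-injective {a} {a′} e with a <? m | a′ <? m
    ... | yes a<m | yes a′<m = f-inj a<m a′<m (trans (sym (extendById-< a<m)) (trans e (extendById-< a′<m)))
    ... | no  a≮m | no  a′≮m = trans (sym (extendById-≮ a≮m)) (trans e (extendById-≮ a′≮m))
    ... | yes a<m | no  a′≮m = contradiction
      (subst (_< m) (trans (sym (extendById-< a<m)) (trans e (extendById-≮ a′≮m))) (f-into a<m)) a′≮m
    ... | no  a≮m | yes a′<m = contradiction
      (subst (_< m) (trans (sym (extendById-< a′<m)) (trans (sym e) (extendById-≮ a≮m))) (f-into a′<m)) a≮m

-- mark fixes the p-points of [0, L) and sends each other point to the next non-p point, or to L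
module Mark (L : ℕ) (p : ℕ → Bool) where

  search : ℕ → ℕ → ℕ
  search zero       b = b
  search (suc fuel) b = if p b then search fuel (suc b) else b

  record SearchResult (b r : ℕ) : Set where
    field
      start≤ : b ≤ r
      ≤L     : r ≤ L
      stops  : r < L → p r ≡ false
      skips  : ∀ {y} → b ≤ y → y < r → p y ≡ true

  search-result : ∀ fuel b → fuel + b ≡ L → SearchResult b (search fuel b)
  search-result zero b refl = record
    { start≤ = ≤-refl ; ≤L = ≤-refl ; stops = λ b<b → contradiction b<b (<-irrefl refl)
    ; skips = λ b≤y y<b → contradiction (≤-<-trans b≤y y<b) (<-irrefl refl) }
  search-result (suc fuel) b e with p b in pb
  ... | false = record
    { start≤ = ≤-refl ; ≤L = subst (b ≤_) e (m≤n+m b (suc fuel)) ; stops = λ _ → pb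
    ; skips = λ b≤y y<b → contradiction (≤-<-trans b≤y y<b) (<-irrefl refl) }
  ... | true  = record
    { start≤ = ≤-trans (n≤1+n b) start≤ ; ≤L = ≤L ; stops = stops ; skips = skips′ }
    where
      open SearchResult (search-result fuel (suc b) (trans (+-suc fuel b) e))
      skips′ : ∀ {y} → b ≤ y → y < search fuel (suc b) → p y ≡ true
      skips′ b≤y y<r with m≤n⇒m<n∨m≡n b≤y
      ... | inj₁ b<y  = skips b<y y<r
      ... | inj₂ refl = pb

  -- the first y > a with y = L or p y ≡ false
  next : ℕ → ℕ
  next a = search (L ∸ suc a) (suc a)

  next-result : ∀ {a} → a < L → SearchResult (suc a) (next a)
  next-result {a} a<L = search-result (L ∸ suc a) (suc a) (m∸n+n≡m a<L)

  next-least : ∀ {a y} → a < y → y < L → p y ≡ false → next a ≤ y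
  next-least {a} {y} a<y y<L py with y <? next a
  ... | yes y<next = contradiction (trans (sym py) (SearchResult.skips (next-result (<-trans a<y y<L)) a<y y<next)) false≢true
  ... | no  y≮next = ≮⇒≥ y≮next

  mark : ℕ → ℕ
  mark a = if p a then a else next a

  mark-fixed⇐ : ∀ {a} → p a ≡ true → mark a ≡ a
  mark-fixed⇐ pa rewrite pa = refl

  mark-into : MapsInto L (suc L) mark
  mark-into {a} a<L with p a
  ... | true  = <-trans a<L (n<1+n L)
  ... | false = s≤s (SearchResult.≤L (next-result a<L))

  mark-fixed⇒ : ∀ {a} → a < L → mark a ≡ a → p a ≡ true
  mark-fixed⇒ {a} a<L e with p a in pa
  ... | true  = refl
  ... | false = contradiction e (>⇒≢ (SearchResult.start≤ (next-result a<L)))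

  private
    true≢next : ∀ {a a′} → a < L → a′ < L → p a ≡ true → p a′ ≡ false → a ≢ next a′
    true≢next a<L a′<L pa pa′ refl = contradiction (trans (sym (SearchResult.stops (next-result a′<L) a<L)) pa) false≢true

    next-<-mono : ∀ {a a′} → a < a′ → a′ < L → p a′ ≡ false → next a < next a′
    next-<-mono a<a′ a′<L pa′ = ≤-<-trans (next-least a<a′ a′<L pa′) (SearchResult.start≤ (next-result a′<L))

  mark-injective : InjectiveOn L mark
  mark-injective {a} {a′} a<L a′<L e with p a in pa | p a′ in pa′
  ... | true  | true  = e
  ... | true  | false = contradiction e (true≢next a<L a′<L pa pa′)
  ... | false | true  = contradiction (sym e) (true≢next a′<L a<L pa′ pa)
  ... | false | false with <-cmp a a′
  ...   | tri< a<a′ _ _ = contradiction e (<⇒≢ (next-<-mono a<a′ a′<L pa′))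
  ...   | tri≈ _ a≡a′ _ = a≡a′
  ...   | tri> _ _ a>a′ = contradiction (sym e) (<⇒≢ (next-<-mono a>a′ a<L pa))

  module _ {n : ℕ} (L<n : L < n) where

    markGraph-isPartialInjOfSize : IsPartialInjOfSize n L (graph n L mark)
    markGraph-isPartialInjOfSize =
      graph-isPartialInjOfSize (λ a<L → ≤-trans (mark-into a<L) L<n) (<⇒≤ L<n) mark-injective

    markGraph-loop⇒ : ∀ {a : Fin n} → graph n L mark a a ≡ true → toℕ a < L × p (toℕ a) ≡ true
    markGraph-loop⇒ aa = let a<L , a≡ma = graph⇒ aa in a<L , mark-fixed⇒ a<L (sym a≡ma)

    markGraph-loop⇐ : ∀ {a : Fin n} → toℕ a < L → p (toℕ a) ≡ true → graph n L mark a a ≡ true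
    markGraph-loop⇐ a<L pa = ⇒graph a<L (sym (mark-fixed⇐ pa))

extend-pointwise : ∀ {A B : Set} (_∼_ : A → B → Set) {m} {a b} {ρ : Fin m → A} {ρ′ : Fin m → B} →
                   a ∼ b → (∀ x → ρ x ∼ ρ′ x) → ∀ x → extend a ρ x ∼ extend b ρ′ x
extend-pointwise _∼_ a∼b ρ∼ρ′ zero    = a∼b
extend-pointwise _∼_ a∼b ρ∼ρ′ (suc x) = ρ∼ρ′ x

module Transport {n : ℕ} (L : ℕ) where

  _≈⟨_⟩_ : Rel₂ n → Permutation′ n → Rel₂ n → Set
  T ≈⟨ π ⟩ T′ = ∀ a b → T a b ≡ T′ (π ⟨$⟩ʳ a) (π ⟨$⟩ʳ b)

  isPartialInjOfSize-pullback : (π : Permutation′ n) {T T′ : Rel₂ n} → T ≈⟨ π ⟩ T′ →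
                                IsPartialInjOfSize n L T′ → IsPartialInjOfSize n L T
  isPartialInjOfSize-pullback π {T} {T′} T≈T′ (functional , injective , size) =
      (λ a b b′ ab ab′ → to-injective (functional _ _ _ (trans (sym (T≈T′ a b)) ab) (trans (sym (T≈T′ a b′)) ab′)))
    , (λ a a′ b ab a′b → to-injective (injective _ _ _ (trans (sym (T≈T′ a b)) ab) (trans (sym (T≈T′ a′ b)) a′b)))
    , (begin
        countB n (λ a → anyB n (T a))                                    ≡⟨ countB-cong (λ a → anyB-cong (T≈T′ a)) ⟩
        countB n (λ a → anyB n (λ b → T′ (π ⟨$⟩ʳ a) (π ⟨$⟩ʳ b)))          ≡⟨ countB-cong (λ a → anyB-permute π (T′ (π ⟨$⟩ʳ a))) ⟩
        countB n (λ a → anyB n (T′ (π ⟨$⟩ʳ a)))                          ≡⟨ countB-permute π (λ a → anyB n (T′ a)) ⟩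
        countB n (λ a → anyB n (T′ a))                                   ≡⟨ size ⟩
        L                                                                ∎)
    where
      open ≡-Reasoning
      to-injective : ∀ {x y} → π ⟨$⟩ʳ x ≡ π ⟨$⟩ʳ y → x ≡ y
      to-injective = Injection.injective (↔⇒↣ π)

  module _ (π : Permutation′ n) where

    _↦_ : Fin n → Fin n → Set
    u ↦ u′ = u′ ≡ π ⟨$⟩ʳ u

    private
      push : Rel₂ n → Rel₂ n
      push S a b = S (π ⟨$⟩ˡ a) (π ⟨$⟩ˡ b)

      pull : Rel₂ n → Rel₂ n
      pull S′ a b = S′ (π ⟨$⟩ʳ a) (π ⟨$⟩ʳ b)

      ≈push : ∀ S → S ≈⟨ π ⟩ push S
      ≈push S a b = sym (cong₂ S (Inverse.strictlyInverseʳ π a) (Inverse.strictlyInverseʳ π b))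

      push≈ : ∀ {S S′} → S ≈⟨ π ⟩ S′ → S′ ≈⟨ flip π ⟩ S
      push≈ {S} {S′} S≈S′ a b =
        sym (trans (S≈S′ _ _) (cong₂ S′ (Inverse.strictlyInverseˡ π a) (Inverse.strictlyInverseˡ π b)))

    Sat-transport : ∀ {v r} (φ : Formula v r) {ρ ρ′ σ σ′} →
                    (∀ x → ρ x ↦ ρ′ x) → (∀ j → σ j ≈⟨ π ⟩ σ′ j) →
                    Sat n L φ ρ σ ⇔ Sat n L φ ρ′ σ′
    Sat-transport (eq x y) ρ′≡ σ≈ = mk⇔
      (λ ρx≡ρy → trans (ρ′≡ x) (trans (cong (π ⟨$⟩ʳ_) ρx≡ρy) (sym (ρ′≡ y))))
      (λ ρ′x≡ρ′y → Injection.injective (↔⇒↣ π) (trans (sym (ρ′≡ x)) (trans ρ′x≡ρ′y (ρ′≡ y))))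
    Sat-transport (rel j x y) {σ′ = σ′} ρ′≡ σ≈ = mk⇔
      (λ s → trans (cong₂ (σ′ j) (ρ′≡ x) (ρ′≡ y)) (trans (sym (σ≈ j _ _)) s))
      (λ s → trans (σ≈ j _ _) (trans (sym (cong₂ (σ′ j) (ρ′≡ x) (ρ′≡ y))) s))
    Sat-transport (neg φ) ρ′≡ σ≈ = let φ⇔ = Sat-transport φ ρ′≡ σ≈ in
      mk⇔ (λ ¬s s′ → ¬s (Equivalence.from φ⇔ s′)) (λ ¬s′ s → ¬s′ (Equivalence.to φ⇔ s))
    Sat-transport (conj φ ψ) ρ′≡ σ≈ = let φ⇔ = Sat-transport φ ρ′≡ σ≈ ; ψ⇔ = Sat-transport ψ ρ′≡ σ≈ in
      mk⇔ (λ (s , t) → Equivalence.to φ⇔ s , Equivalence.to ψ⇔ t)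
          (λ (s , t) → Equivalence.from φ⇔ s , Equivalence.from ψ⇔ t)
    Sat-transport (ex φ) ρ′≡ σ≈ = mk⇔
      (λ (a , s) → π ⟨$⟩ʳ a , Equivalence.to (Sat-transport φ (extend-pointwise _↦_ refl ρ′≡) σ≈) s)
      (λ (a′ , s′) → π ⟨$⟩ˡ a′ ,
         Equivalence.from (Sat-transport φ (extend-pointwise _↦_ (sym (Inverse.strictlyInverseˡ π a′)) ρ′≡) σ≈) s′)
    Sat-transport (q11 φ) ρ′≡ σ≈ = mk⇔
      (λ (S , S-inj , s) → push S , isPartialInjOfSize-pullback (flip π) (push≈ (≈push S)) S-inj ,
         Equivalence.to (Sat-transport φ ρ′≡ (extend-pointwise _≈⟨ π ⟩_ (≈push S) σ≈)) s)
      (λ (S′ , S′-inj , s′) → pull S′ , isPartialInjOfSize-pullback π (λ _ _ → refl) S′-inj ,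
         Equivalence.from (Sat-transport φ ρ′≡ (extend-pointwise _≈⟨ π ⟩_ (λ _ _ → refl) σ≈)) s′)

toℕ-punchIn-< : ∀ {n} (i : Fin (suc n)) (y : Fin n) → toℕ y < toℕ i → toℕ (punchIn i y) ≡ toℕ y
toℕ-punchIn-< (suc i) zero    _         = refl
toℕ-punchIn-< (suc i) (suc y) (s≤s y<i) = cong suc (toℕ-punchIn-< i y y<i)

frontPermutation : ∀ {n} (p : Subset n) → Σ (Permutation′ n) (λ π → ∀ {x} → x ∈ p → toℕ (π ⟨$⟩ʳ x) < ∣ p ∣)
frontPermutation [] = id , λ ()
frontPermutation (true ∷ p) =
  let π , front = frontPermutation p in
  lift₀ π , λ { here → s≤s z≤n ; (there x∈p) → s≤s (front x∈p) }
frontPermutation {suc n} (false ∷ p) = insert zero last π , λ { (there x∈p) → subst (_< ∣ p ∣) (sym (stays x∈p)) (front x∈p) }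
  where
    π : Permutation′ n
    π = proj₁ (frontPermutation p)
    front : ∀ {x} → x ∈ p → toℕ (π ⟨$⟩ʳ x) < ∣ p ∣
    front = proj₂ (frontPermutation p)
    last : Fin (suc n)
    last = fromℕ< (s≤s (∣p∣≤n p))
    stays : ∀ {x} → x ∈ p → toℕ (insert zero last π ⟨$⟩ʳ suc x) ≡ toℕ (π ⟨$⟩ʳ x)
    stays {x} x∈p = trans (cong toℕ (insert-punchIn zero last π x))
      (toℕ-punchIn-< last (π ⟨$⟩ʳ x) (subst (toℕ (π ⟨$⟩ʳ x) <_) (sym (toℕ-fromℕ< (s≤s (∣p∣≤n p)))) (front x∈p)))

downward-induction : ∀ (P : ℕ → Set) {top} → P top → (∀ {q} → q < top → P (suc q) → P q) → ∀ {q} → q ≤ top → P q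
downward-induction P {top} P-top step {q} q≤top = subst P (m∸[m∸n]≡n q≤top) (below (top ∸ q) (m∸n≤m top q))
  where
    below : ∀ m → m ≤ top → P (top ∸ m)
    below zero    _      = P-top
    below (suc m) m<top  = step (∸-monoʳ-< (s≤s z≤n) m<top)
                                (subst P (+-∸-assoc 1 m<top) (below m (<⇒≤ m<top)))

module Radix (s₀ : ℕ) where

  s : ℕ
  s = suc s₀

  [x+s*q]%s≡x : ∀ {x} q → x < s → (x + s * q) % s ≡ x
  [x+s*q]%s≡x {x} q x<s = trans (cong (λ z → (x + z) % s) (*-comm s q)) (trans ([m+kn]%n≡m%n x q s) (m<n⇒m%n≡m x<s))

  [x+s*q]/s≡q : ∀ {x} q → x < s → (x + s * q) / s ≡ q
  [x+s*q]/s≡q {x} q x<s = trans (cong (λ z → (x + z) / s) (*-comm s q))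
    (trans (+-distrib-/-∣ʳ x (divides q refl)) (cong₂ _+_ (m<n⇒m/n≡0 x<s) (m*n/n≡m q s)))

  x+s*q<s*N : ∀ {x q N} → x < s → q < N → x + s * q < s * N
  x+s*q<s*N {x} {q} {N} x<s q<N = begin-strict
    x + s * q <⟨ +-monoˡ-< (s * q) x<s ⟩
    s + s * q ≡⟨ *-suc s q ⟨
    s * suc q ≤⟨ *-monoʳ-≤ s q<N ⟩
    s * N     ∎
    where open ≤-Reasoning

  x+s*q-injective : ∀ {x q x′ q′} → x < s → x′ < s → x + s * q ≡ x′ + s * q′ → x ≡ x′ × q ≡ q′
  x+s*q-injective {x} {q} {x′} {q′} x<s x′<s e =
      trans (sym ([x+s*q]%s≡x q x<s)) (trans (cong (_% s) e) ([x+s*q]%s≡x q′ x′<s))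
    , trans (sym ([x+s*q]/s≡q q x<s)) (trans (cong (_/ s) e) ([x+s*q]/s≡q q′ x′<s))

  c≡c%s+s*[c/s] : ∀ c → c ≡ c % s + s * (c / s)
  c≡c%s+s*[c/s] c = trans (m≡m%n+[m/n]*n c s) (cong (c % s +_) (*-comm (c / s) s))

  c%s<s : ∀ c → c % s < s
  c%s<s c = m%n<n c s

  c<s*N⇒c/s<N : ∀ {c N} → c < s * N → c / s < N
  c<s*N⇒c/s<N {c} {N} c<sN = m<n*o⇒m/o<n (subst (c <_) (*-comm s N) c<sN)

  digit : ℕ → ℕ → ℕ
  digit c zero    = c % s
  digit c (suc j) = digit (c / s) j

  digit-< : ∀ c j → digit c j < s
  digit-< c zero    = c%s<s c
  digit-< c (suc j) = digit-< (c / s) j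

  encode : (ℕ → ℕ) → ℕ → ℕ
  encode v zero    = 0
  encode v (suc m) = v 0 + s * encode (λ i → v (suc i)) m

  Digits : (ℕ → ℕ) → Set
  Digits v = ∀ i → v i < s

  encode-< : ∀ m {v} → Digits v → encode v m < s ^ m
  encode-< zero    v<s = s≤s z≤n
  encode-< (suc m) v<s = x+s*q<s*N (v<s 0) (encode-< m (λ i → v<s (suc i)))

  digit-encode : ∀ m {v} → Digits v → ∀ {j} → j < m → digit (encode v m) j ≡ v j
  digit-encode (suc m) v<s {zero}  _         = [x+s*q]%s≡x _ (v<s 0)
  digit-encode (suc m) {v} v<s {suc j} (s≤s j<m) =
    trans (cong (λ z → digit z j) ([x+s*q]/s≡q _ (v<s 0))) (digit-encode m (λ i → v<s (suc i)) j<m)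

  encode-digit : ∀ m {c} → c < s ^ m → encode (digit c) m ≡ c
  encode-digit zero    {zero}  _          = refl
  encode-digit zero    {suc c} (s≤s ())
  encode-digit (suc m) {c}     c<s^m =
    trans (cong (λ z → c % s + s * z) (encode-digit m (c<s*N⇒c/s<N c<s^m))) (sym (c≡c%s+s*[c/s] c))

  encode-cong : ∀ m {v w} → (∀ {i} → i < m → v i ≡ w i) → encode v m ≡ encode w m
  encode-cong zero    v≗w = refl
  encode-cong (suc m) v≗w = cong₂ (λ a b → a + s * b) (v≗w (s≤s z≤n)) (encode-cong m (λ i<m → v≗w (s≤s i<m)))

  swap₀ : ℕ → (ℕ → ℕ) → ℕ → ℕ
  swap₀ j v zero    = v j
  swap₀ j v (suc i) = if suc i ≡ᵇ j then v 0 else v (suc i)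

  swap₀-digits : ∀ j {v} → Digits v → Digits (swap₀ j v)
  swap₀-digits j v<s zero    = v<s j
  swap₀-digits j v<s (suc i) with suc i ≡ᵇ j
  ... | true  = v<s 0
  ... | false = v<s (suc i)

  swap₀-involutive : ∀ j v i → swap₀ j (swap₀ j v) i ≡ v i
  swap₀-involutive zero    v zero = refl
  swap₀-involutive (suc j) v zero rewrite ≡⇒≡ᵇ≡true {suc j} refl = refl
  swap₀-involutive j v (suc i) with suc i ≡ᵇ j in i+1≡ᵇj
  ... | true  = cong v (sym (≡ᵇ≡true⇒≡ i+1≡ᵇj))
  ... | false = refl

  swap₀-cong : ∀ {m j v w} → j < m → (∀ {i} → i < m → v i ≡ w i) → ∀ {i} → i < m → swap₀ j v i ≡ swap₀ j w i
  swap₀-cong j<m v≗w {zero}  _   = v≗w j<m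
  swap₀-cong {j = j} j<m v≗w {suc i} i<m with suc i ≡ᵇ j
  ... | true  = v≗w (≤-trans (s≤s z≤n) i<m)
  ... | false = v≗w i<m

  module Codes (k′ : ℕ) where

    N : ℕ
    N = s ^ k′

    N>0 : N > 0
    N>0 = m^n>0 s k′

    s≤s*N : s ≤ s * N
    s≤s*N = subst (_≤ s * N) (*-identityʳ s) (*-monoʳ-≤ s N>0)

    digitSwap : ℕ → ℕ → ℕ
    digitSwap j c = encode (swap₀ j (digit c)) (suc k′)

    digitSwap-< : ∀ j c → digitSwap j c < s * N
    digitSwap-< j c = encode-< (suc k′) (swap₀-digits j (digit-< c))

    digitSwap%s : ∀ {j} c → j < suc k′ → digitSwap j c % s ≡ digit c j
    digitSwap%s {j} c j<k = digit-encode (suc k′) (swap₀-digits j (digit-< c)) (s≤s z≤n)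

    digitSwap-injective : ∀ {j} → j < suc k′ → InjectiveOn (s * N) (digitSwap j)
    digitSwap-injective {j} j<k {c} {c′} c<sN c′<sN e = begin
      c                           ≡⟨ encode-digit (suc k′) c<sN ⟨
      encode (digit c) (suc k′)   ≡⟨ encode-cong (suc k′) same-digits ⟩
      encode (digit c′) (suc k′)  ≡⟨ encode-digit (suc k′) c′<sN ⟩
      c′                          ∎
      where
        open ≡-Reasoning
        same-swapped : ∀ {i} → i < suc k′ → swap₀ j (digit c) i ≡ swap₀ j (digit c′) i
        same-swapped {i} i<k = trans (sym (digit-encode (suc k′) (swap₀-digits j (digit-< c)) i<k))
          (trans (cong (λ z → digit z i) e) (digit-encode (suc k′) (swap₀-digits j (digit-< c′)) i<k))
        same-digits : ∀ {i} → i < suc k′ → digit c i ≡ digit c′ i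
        same-digits {i} i<k = trans (sym (swap₀-involutive j (digit c) i))
          (trans (swap₀-cong j<k same-swapped i<k) (swap₀-involutive j (digit c′) i))

    cyclicSuc : ℕ → ℕ
    cyclicSuc q = if suc q <ᵇ N then suc q else 0

    cyclicSuc-<N : ∀ q → cyclicSuc q < N
    cyclicSuc-<N q with suc q <ᵇ N in q+1<ᵇN
    ... | true  = <ᵇ≡true⇒< q+1<ᵇN
    ... | false = N>0

    cyclicSuc-< : ∀ {q} → suc q < N → cyclicSuc q ≡ suc q
    cyclicSuc-< q+1<N rewrite <⇒<ᵇ≡true q+1<N = refl

    cyclicSuc-≮ : ∀ {q} → ¬ suc q < N → cyclicSuc q ≡ 0
    cyclicSuc-≮ {q} q+1≮N with suc q <ᵇ N in q+1<ᵇN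
    ... | true  = contradiction (<ᵇ≡true⇒< q+1<ᵇN) q+1≮N
    ... | false = refl

    cyclicSuc-injective : InjectiveOn N cyclicSuc
    cyclicSuc-injective {q} {q′} q<N q′<N e with suc q <? N | suc q′ <? N
    ... | yes q+1<N | yes q′+1<N = suc-injective (trans (sym (cyclicSuc-< q+1<N)) (trans e (cyclicSuc-< q′+1<N)))
    ... | yes q+1<N | no  q′+1≮N = contradiction (trans (sym (cyclicSuc-< q+1<N)) (trans e (cyclicSuc-≮ q′+1≮N))) λ ()
    ... | no  q+1≮N | yes q′+1<N = contradiction (trans (sym (cyclicSuc-< q′+1<N)) (trans (sym e) (cyclicSuc-≮ q+1≮N))) λ ()
    ... | no  q+1≮N | no  q′+1≮N =
      suc-injective (trans (≤-antisym q<N (≮⇒≥ q+1≮N)) (sym (≤-antisym q′<N (≮⇒≥ q′+1≮N))))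

    cyclicSuc-fixed : ∀ {q} → cyclicSuc q ≡ q → N ≤ 1
    cyclicSuc-fixed {q} e with suc q <? N
    ... | yes q+1<N = contradiction (trans (sym (cyclicSuc-< q+1<N)) e) (<⇒≢ (n<1+n q) ∘ sym)
    ... | no  q+1≮N = subst (λ z → N ≤ suc z) (trans (sym e) (cyclicSuc-≮ q+1≮N)) (≮⇒≥ q+1≮N)

    suc-pred-N : suc (pred N) ≡ N
    suc-pred-N = suc-pred N {{>-nonZero N>0}}

    cyclicSuc-last : cyclicSuc (pred N) ≡ 0
    cyclicSuc-last = cyclicSuc-≮ (λ N<N → <-irrefl suc-pred-N N<N)

    rotate : ℕ → ℕ
    rotate c = c % s + s * cyclicSuc (c / s)

    rotate-< : ∀ c → rotate c < s * N
    rotate-< c = x+s*q<s*N (c%s<s c) (cyclicSuc-<N _)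

    rotate%s : ∀ c → rotate c % s ≡ c % s
    rotate%s c = [x+s*q]%s≡x _ (c%s<s c)

    rotate-x+s*q : ∀ {x} q → x < s → rotate (x + s * q) ≡ x + s * cyclicSuc q
    rotate-x+s*q q x<s = cong₂ (λ a b → a + s * cyclicSuc b) ([x+s*q]%s≡x q x<s) ([x+s*q]/s≡q q x<s)

    rotate-injective : InjectiveOn (s * N) rotate
    rotate-injective {c} {c′} c<sN c′<sN e =
      let same-low , same-high = x+s*q-injective (c%s<s c) (c%s<s c′) e in begin
      c                       ≡⟨ c≡c%s+s*[c/s] c ⟩
      c % s + s * (c / s)     ≡⟨ cong₂ (λ a b → a + s * b) same-low
                                   (cyclicSuc-injective (c<s*N⇒c/s<N c<sN) (c<s*N⇒c/s<N c′<sN) same-high) ⟩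
      c′ % s + s * (c′ / s)   ≡⟨ c≡c%s+s*[c/s] c′ ⟨
      c′                      ∎
      where open ≡-Reasoning

    rotate-fixed : ∀ {c} → rotate c ≡ c → N ≤ 1
    rotate-fixed {c} e = cyclicSuc-fixed (proj₂ (x+s*q-injective (c%s<s c) (c%s<s c) (trans e (c≡c%s+s*[c/s] c))))

    shift : ℕ → ℕ
    shift = extendById (s * N) rotate

_∨ᶠ_ : ∀ {v r} → Formula v r → Formula v r → Formula v r
φ ∨ᶠ ψ = neg (conj (neg φ) (neg ψ))

⋀ : ∀ {v r} m → (Fin (suc m) → Formula v r) → Formula v r
⋀ zero    φ = φ zero
⋀ (suc m) φ = conj (φ zero) (⋀ m (λ j → φ (suc j)))

Admissible : ∀ {n} → Rel₂ n → Rel₂ n → Set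
Admissible {n} T S = ∀ a b → T a b ≡ true → S a b ≡ true ⊎ (a ≡ b × Σ (Fin n) (λ c → S a c ≡ true))

Adm : ∀ {v r} → Fin r → Fin r → Formula v r
Adm T S = neg (ex (ex (conj (rel T (suc zero) zero)
            (neg (rel S (suc zero) zero ∨ᶠ conj (eq (suc zero) zero) (ex (rel S (suc (suc zero)) zero)))))))

module _ {n L : ℕ} where

  Sat-⋀ : ∀ {v r} m (φ : Fin (suc m) → Formula v r) {ρ σ} → Sat n L (⋀ m φ) ρ σ ⇔ (∀ j → Sat n L (φ j) ρ σ)
  Sat-⋀ zero    φ = mk⇔ (λ { s zero → s }) (λ s → s zero)
  Sat-⋀ (suc m) φ = mk⇔
    (λ { (s , _) zero → s ; (_ , t) (suc j) → Equivalence.to (Sat-⋀ m (λ j → φ (suc j))) t j })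
    (λ s → s zero , Equivalence.from (Sat-⋀ m (λ j → φ (suc j))) (λ j → s (suc j)))

  Sat-Adm : ∀ {v r} (T S : Fin r) {ρ : Fin v → Fin n} {σ} → Sat n L (Adm T S) ρ σ ⇔ Admissible (σ T) (σ S)
  Sat-Adm T S {ρ} {σ} = mk⇔ admissible λ adm (a , b , Tab , ¬edge) → ¬edge (λ (¬Sab , ¬loop) →
    [ ¬Sab , ¬loop ] (adm a b Tab))
    where
      admissible : Sat n L (Adm T S) ρ σ → Admissible (σ T) (σ S)
      admissible ¬bad a b Tab with σ S a b in Sab
      ... | true = inj₁ refl
      ... | false with a ≟ᶠ b | anyB n (σ S a) in anyS
      ...   | yes refl | true  = inj₂ (refl , anyB⇒∃ {n} {σ S a} anyS)
      ...   | yes refl | false = ⊥-elim (¬bad (a , a , Tab , λ k → k (false≢true ∘ trans (sym Sab) ,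
                                   λ (_ , c , Sac) → false≢true (trans (sym anyS) (∃⇒anyB c Sac)))))
      ...   | no  a≢b  | _     = ⊥-elim (¬bad (a , b , Tab , λ k → k (false≢true ∘ trans (sym Sab) , a≢b ∘ proj₁)))

module _ {n L : ℕ} {T : Rel₂ n} {F : ℕ → ℕ} (L≤n : L ≤ n)
         (T-inj : IsPartialInjOfSize n L T) (T-adm : Admissible T (graph n L F)) where

  private
    domain-source : ∀ a → anyB n (T a) ≡ true → (toℕ a <ᵇ L) ≡ true
    domain-source a a∈domT with T-adm a _ (proj₂ (anyB⇒∃ {n} {T a} a∈domT))
    ... | inj₁ a↦b            = <⇒<ᵇ≡true (proj₁ (graph⇒ a↦b))
    ... | inj₂ (_ , _ , a↦c)  = <⇒<ᵇ≡true (proj₁ (graph⇒ a↦c))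

  -- T is defined on all of [0, L) because its domain lies there and has L elements
  admissible-total : ∀ b → toℕ b < L → Σ (Fin n) (λ y → T b y ≡ true)
  admissible-total b b<L = anyB⇒∃
    (countB-⊆-≡⇒⊇ domain-source (trans (proj₂ (proj₂ T-inj)) (sym (countB-<ᵇ L≤n))) b (<⇒<ᵇ≡true b<L))

  admissible-loop-pullback : ∀ {a b} → T a a ≡ true → toℕ b < L → F (toℕ b) ≡ toℕ a → T b b ≡ true
  admissible-loop-pullback {a} {b} Taa b<L Fb≡a with admissible-total b b<L
  ... | y , Tby with T-adm b y Tby
  ...   | inj₂ (refl , _) = Tby
  ...   | inj₁ b↦y with toℕ-injective (trans (proj₂ (graph⇒ b↦y)) Fb≡a)
  ...     | refl = subst (λ z → T z z ≡ true) (sym (proj₁ (proj₂ T-inj) b a a Tby Taa)) Taa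

module Columns (s₀ k′ : ℕ) {n L : ℕ} (sN≤L : suc s₀ * suc s₀ ^ k′ ≤ L) (L<n : L < n) where
  open Radix s₀
  open Codes k′

  shift-into : MapsInto L n shift
  shift-into a<L = <-trans (extendById-into (s * N) rotate (λ {c} _ → rotate-< c) rotate-injective sN≤L a<L) L<n

  shiftGraph-isPartialInjOfSize : IsPartialInjOfSize n L (graph n L shift)
  shiftGraph-isPartialInjOfSize = graph-isPartialInjOfSize shift-into (<⇒≤ L<n)
    (λ _ _ → extendById-injective (s * N) rotate (λ {c} _ → rotate-< c) rotate-injective)

  module _ {T : Rel₂ n} (T-inj : IsPartialInjOfSize n L T) (T-adm : Admissible T (graph n L shift))
           {X : Fin n} (X<s : toℕ X < s) (TXX : T X X ≡ true) where

    private
      x : ℕ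
      x = toℕ X

      Loops : ℕ → Set
      Loops q = ∀ (c : Fin n) → toℕ c ≡ x + s * q → T c c ≡ true

      x+s*q<L : ∀ {q} → q < N → x + s * q < L
      x+s*q<L q<N = <-≤-trans (x+s*q<s*N X<s q<N) sN≤L

      shift-x+s*q : ∀ {q} → q < N → shift (x + s * q) ≡ x + s * cyclicSuc q
      shift-x+s*q q<N = trans (extendById-< (s * N) rotate (x+s*q<s*N X<s q<N)) (rotate-x+s*q _ X<s)

      pred-N<N : pred N < N
      pred-N<N = subst (pred N <_) suc-pred-N ≤-refl

      last-loops : Loops (pred N)
      last-loops c c≡ = admissible-loop-pullback (<⇒≤ L<n) T-inj T-adm TXX (subst (_< L) (sym c≡) (x+s*q<L pred-N<N))
        (begin
          shift (toℕ c)                 ≡⟨ cong shift c≡ ⟩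
          shift (x + s * pred N)        ≡⟨ shift-x+s*q pred-N<N ⟩
          x + s * cyclicSuc (pred N)    ≡⟨ cong (λ q → x + s * q) cyclicSuc-last ⟩
          x + s * 0                     ≡⟨ cong (x +_) (*-zeroʳ s) ⟩
          x + 0                         ≡⟨ +-identityʳ x ⟩
          x                             ∎)
        where open ≡-Reasoning

      loops-step : ∀ {q} → q < pred N → Loops (suc q) → Loops q
      loops-step {q} q<pred-N loops-next c c≡ =
        admissible-loop-pullback (<⇒≤ L<n) T-inj T-adm (loops-next next next≡) (subst (_< L) (sym c≡) (x+s*q<L q<N))
          (trans (cong shift c≡) (trans (shift-x+s*q q<N) (trans (cong (λ q → x + s * q) (cyclicSuc-< q+1<N)) (sym next≡))))
        where
          q+1<N : suc q < N
          q+1<N = subst (suc q <_) suc-pred-N (s≤s q<pred-N)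
          q<N : q < N
          q<N = <-trans (n<1+n q) q+1<N
          next-bound : x + s * suc q < n
          next-bound = <-trans (x+s*q<L q+1<N) L<n
          next : Fin n
          next = fromℕ< next-bound
          next≡ : toℕ next ≡ x + s * suc q
          next≡ = toℕ-fromℕ< next-bound

    -- walking backwards along the cycle of rotate through x
    loops-on-column : ∀ {D : Fin n} → toℕ D < s * N → toℕ D % s ≡ x → T D D ≡ true
    loops-on-column {D} D<sN D%s≡x =
      downward-induction Loops last-loops loops-step (pred-mono-≤ (c<s*N⇒c/s<N D<sN)) D
        (trans (c≡c%s+s*[c/s] (toℕ D)) (cong (λ z → z + s * (toℕ D / s)) D%s≡x))

  module _ {X : Fin n} (X<s : toℕ X < s) where

    private
      x : ℕ
      x = toℕ X

      fixColumn : ℕ → ℕ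
      fixColumn c = if c % s ≡ᵇ x then c else rotate c

      fixColumn-fixed : ∀ c → c % s ≡ x → fixColumn c ≡ c
      fixColumn-fixed c c%s≡x rewrite ≡⇒≡ᵇ≡true c%s≡x = refl

      fixColumn-moved : ∀ c → c % s ≢ x → fixColumn c ≡ rotate c
      fixColumn-moved c c%s≢x with c % s ≡ᵇ x in c%s≡ᵇx
      ... | true  = contradiction (≡ᵇ≡true⇒≡ c%s≡ᵇx) c%s≢x
      ... | false = refl

      fixColumn-into : MapsInto (s * N) (s * N) fixColumn
      fixColumn-into {c} c<sN with c % s ≟ x
      ... | yes c%s≡x = subst (_< s * N) (sym (fixColumn-fixed c c%s≡x)) c<sN
      ... | no  c%s≢x = subst (_< s * N) (sym (fixColumn-moved c c%s≢x)) (rotate-< c)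

      -- rotate preserves columns, so fixed and moved points never collide
      fixColumn-injective : InjectiveOn (s * N) fixColumn
      fixColumn-injective {c} {c′} c<sN c′<sN e with c % s ≟ x | c′ % s ≟ x
      ... | yes c%s≡x | yes c′%s≡x = trans (sym (fixColumn-fixed c c%s≡x)) (trans e (fixColumn-fixed c′ c′%s≡x))
      ... | no  c%s≢x | no  c′%s≢x =
        rotate-injective c<sN c′<sN (trans (sym (fixColumn-moved c c%s≢x)) (trans e (fixColumn-moved c′ c′%s≢x)))
      ... | yes c%s≡x | no  c′%s≢x = contradiction (trans (sym (rotate%s c′))
            (trans (cong (_% s) (trans (sym (fixColumn-moved c′ c′%s≢x)) (trans (sym e) (fixColumn-fixed c c%s≡x)))) c%s≡x)) c′%s≢x
      ... | no  c%s≢x | yes c′%s≡x = contradiction (trans (sym (rotate%s c))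
            (trans (cong (_% s) (trans (sym (fixColumn-moved c c%s≢x)) (trans e (fixColumn-fixed c′ c′%s≡x)))) c′%s≡x)) c%s≢x

      fix : ℕ → ℕ
      fix = extendById (s * N) fixColumn

      fix-into : MapsInto L n fix
      fix-into a<L = <-trans (extendById-into (s * N) fixColumn fixColumn-into fixColumn-injective sN≤L a<L) L<n

      in-shift-domain : ∀ {a : Fin n} → toℕ a < L → Σ (Fin n) (λ c → graph n L shift a c ≡ true)
      in-shift-domain a<L = fromℕ< (shift-into a<L) , ⇒graph a<L (toℕ-fromℕ< (shift-into a<L))

    columnFixer : Rel₂ n
    columnFixer = graph n L fix

    columnFixer-isPartialInjOfSize : IsPartialInjOfSize n L columnFixer
    columnFixer-isPartialInjOfSize = graph-isPartialInjOfSize fix-into (<⇒≤ L<n)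
      (λ _ _ → extendById-injective (s * N) fixColumn fixColumn-into fixColumn-injective)

    columnFixer-admissible : Admissible columnFixer (graph n L shift)
    columnFixer-admissible a b ab with graph⇒ ab
    ... | a<L , b≡ with toℕ a <? s * N
    ...   | no  a≮sN = inj₂ (toℕ-injective (sym (trans b≡ (extendById-≮ (s * N) fixColumn a≮sN))) , in-shift-domain a<L)
    ...   | yes a<sN with toℕ a % s ≟ x
    ...     | yes a%s≡x = inj₂ (toℕ-injective (sym (trans b≡ (trans (extendById-< (s * N) fixColumn a<sN) (fixColumn-fixed (toℕ a) a%s≡x))))
                               , in-shift-domain a<L)
    ...     | no  a%s≢x = inj₁ (⇒graph a<L (trans b≡ (trans (extendById-< (s * N) fixColumn a<sN)
                               (trans (fixColumn-moved (toℕ a) a%s≢x) (sym (extendById-< (s * N) rotate a<sN))))))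

    columnFixer-loop : columnFixer X X ≡ true
    columnFixer-loop = ⇒graph (<-≤-trans X<sN sN≤L)
      (sym (trans (extendById-< (s * N) fixColumn X<sN) (fixColumn-fixed x (m<n⇒m%n≡m X<s))))
      where
        X<sN : x < s * N
        X<sN = <-≤-trans X<s s≤s*N

    columnFixer-¬loop : 1 < N → ∀ {D : Fin n} → toℕ D < s * N → toℕ D % s ≢ x → columnFixer D D ≢ true
    columnFixer-¬loop 1<N {D} D<sN D%s≢x DD = <⇒≱ 1<N (rotate-fixed
      (sym (trans (proj₂ (graph⇒ DD)) (trans (extendById-< (s * N) fixColumn D<sN) (fixColumn-moved (toℕ D) D%s≢x)))))

SameColumn : ∀ {v r} → Fin r → Fin v → Fin v → Formula v r
SameColumn S x d = neg (q11 (conj (Adm zero (suc S)) (conj (rel zero x x) (neg (rel zero d d)))))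

-- for a single digit rotate is the identity, so the cycle argument is replaced by equality
LowDigit : ∀ {v r} → ℕ → Fin r → Fin v → Fin v → Formula v r
LowDigit zero    S d x = eq d x
LowDigit (suc _) S d x = SameColumn S x d

module _ {n L : ℕ} (s₀ : ℕ) where
  open Radix s₀

  Sat-LowDigit : ∀ k′ → let open Codes k′ in s * N ≤ L → L < n →
                 ∀ {v r} (S : Fin r) (d x : Fin v) {ρ : Fin v → Fin n} {σ} → σ S ≡ graph n L shift →
                 toℕ (ρ d) < s * N → toℕ (ρ x) < s → Sat n L (LowDigit k′ S d x) ρ σ ⇔ toℕ (ρ d) % s ≡ toℕ (ρ x)
  Sat-LowDigit zero sN≤L L<n S d x {ρ} σS≡ d<s*1 x<s = mk⇔
    (λ ρd≡ρx → trans d%s≡d (cong toℕ ρd≡ρx))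
    (λ d%s≡x → toℕ-injective (trans (sym d%s≡d) d%s≡x))
    where
      d%s≡d : toℕ (ρ d) % s ≡ toℕ (ρ d)
      d%s≡d = m<n⇒m%n≡m (subst (toℕ (ρ d) <_) (*-identityʳ s) d<s*1)
  Sat-LowDigit (suc k″) sN≤L L<n {v} {r} S d x {ρ} {σ} σS≡ d<sN x<s = mk⇔ same-column⇒ same-column⇐
    where
      open Codes (suc k″)
      open Columns s₀ (suc k″) sN≤L L<n

      admissible : ∀ {T} → Sat n L (Adm {v} zero (suc S)) ρ (extend T σ) → Admissible T (graph n L shift)
      admissible {T} adm = subst (Admissible T) σS≡ (Equivalence.to (Sat-Adm {L = L} zero (suc S) {ρ} {extend T σ}) adm)

      -- N = s ^ suc k″ ≤ 1 would force s = 1, where every low digit is 0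
      1<N : toℕ (ρ d) % s ≢ toℕ (ρ x) → 1 < N
      1<N d%s≢x with N ≤? 1
      ... | no  N≰1 = ≰⇒> N≰1
      ... | yes N≤1 = contradiction
        (trans (n<1⇒n≡0 (<-≤-trans (c%s<s (toℕ (ρ d))) s≤1)) (sym (n<1⇒n≡0 (<-≤-trans x<s s≤1)))) d%s≢x
        where
          s≤1 : s ≤ 1
          s≤1 = ≤-trans (Codes.s≤s*N k″) N≤1

      same-column⇒ : Sat n L (SameColumn S x d) ρ σ → toℕ (ρ d) % s ≡ toℕ (ρ x)
      same-column⇒ no-separator with toℕ (ρ d) % s ≟ toℕ (ρ x)
      ... | yes d%s≡x = d%s≡x
      ... | no  d%s≢x = ⊥-elim (no-separator (columnFixer x<s , columnFixer-isPartialInjOfSize x<s ,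
            Equivalence.from (Sat-Adm {L = L} zero (suc S) {ρ} {extend (columnFixer x<s) σ})
              (subst (Admissible (columnFixer x<s)) (sym σS≡) (columnFixer-admissible x<s)) ,
            columnFixer-loop x<s , columnFixer-¬loop x<s (1<N d%s≢x) d<sN d%s≢x))

      same-column⇐ : toℕ (ρ d) % s ≡ toℕ (ρ x) → Sat n L (SameColumn S x d) ρ σ
      same-column⇐ d%s≡x (T , T-inj , adm , Txx , ¬Tdd) = ¬Tdd (loops-on-column T-inj (admissible adm) x<s Txx d<sN d%s≡x)

-- Relation variable 0 will have loops exactly at the codes of R-tuples, 1 at the digits, 2 is shift
-- and 3 + j is digitSwap j: some code c has, for each j, a digitSwap j-image whose low digit is vⱼ.
DigitMatches : (k′ : ℕ) → Fin (suc k′) → Formula (suc (suc k′)) (3 + suc k′)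
DigitMatches k′ j = conj (rel (suc zero) (suc j) (suc j))
  (ex (conj (rel (suc (suc (suc j))) (suc zero) zero) (LowDigit k′ (suc (suc zero)) zero (suc (suc j)))))

Φ : (k′ : ℕ) → Formula (suc k′) (3 + suc k′)
Φ k′ = ex (conj (rel zero zero zero) (⋀ k′ (DigitMatches k′)))

Expresses : (n L : ℕ) {k m : ℕ} → Formula k m → RelK n k → Set
Expresses n L {k} {m} φ R = Σ (Fin m → Rel₂ n) (λ S →
  (∀ j → IsPartialInjOfSize n L (S j)) × (∀ (v : Vec (Fin n) k) → (R v ≡ true) ⇔ Sat n L φ (lookup v) S))

digitsOf : ∀ {n m} → Vec (Fin n) m → ℕ → ℕ
digitsOf []      i       = 0
digitsOf (a ∷ w) zero    = toℕ a
digitsOf (a ∷ w) (suc i) = digitsOf w i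

digitsOf-lookup : ∀ {n m} (w : Vec (Fin n) m) (j : Fin m) → digitsOf w (toℕ j) ≡ toℕ (lookup w j)
digitsOf-lookup (a ∷ w) zero    = refl
digitsOf-lookup (a ∷ w) (suc j) = digitsOf-lookup w j

digitsOf-< : ∀ {n m s} → s > 0 → (w : Vec (Fin n) m) → (∀ j → toℕ (lookup w j) < s) → ∀ i → digitsOf w i < s
digitsOf-< s>0 []      w<s i       = s>0
digitsOf-< s>0 (a ∷ w) w<s zero    = w<s zero
digitsOf-< s>0 (a ∷ w) w<s (suc i) = digitsOf-< s>0 w (λ j → w<s (suc j)) i

module Canonical {n L : ℕ} (s₀ k′ : ℕ) (sN≤L : suc s₀ * suc s₀ ^ k′ ≤ L) (L<n : L < n) (R : RelK n (suc k′))
                 (R-digits : ∀ w → R w ≡ true → ∀ j → toℕ (lookup w j) < suc s₀) where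
  open Radix s₀
  open Codes k′

  private
    k : ℕ
    k = suc k′

    s≤L : s ≤ L
    s≤L = ≤-trans s≤s*N sN≤L

    digit<n : ∀ c j → digit c j < n
    digit<n c j = <-trans (digit-< c j) (≤-<-trans s≤L L<n)

  decode : ℕ → Vec (Fin n) k
  decode c = tabulate (λ j → fromℕ< (digit<n c (toℕ j)))

  decode-digits : ∀ {c} {w : Vec (Fin n) k} → (∀ j → digit c (toℕ j) ≡ toℕ (lookup w j)) → decode c ≡ w
  decode-digits {c} {w} digits≡ =
    trans (tabulate-cong (λ j → toℕ-injective (trans (toℕ-fromℕ< (digit<n c (toℕ j))) (digits≡ j)))) (tabulate∘lookup w)

  isCode : ℕ → Bool
  isCode c = (c <ᵇ s * N) ∧ R (decode c)

  isDigit : ℕ → Bool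
  isDigit c = c <ᵇ s

  structure : Fin (3 + k) → Rel₂ n
  structure zero                = graph n L (Mark.mark L isCode)
  structure (suc zero)          = graph n L (Mark.mark L isDigit)
  structure (suc (suc zero))    = graph n L shift
  structure (suc (suc (suc j))) = graph n L (extendById (s * N) (digitSwap (toℕ j)))

  structure-isPartialInjOfSize : ∀ j → IsPartialInjOfSize n L (structure j)
  structure-isPartialInjOfSize zero                = Mark.markGraph-isPartialInjOfSize L isCode L<n
  structure-isPartialInjOfSize (suc zero)          = Mark.markGraph-isPartialInjOfSize L isDigit L<n
  structure-isPartialInjOfSize (suc (suc zero))    = Columns.shiftGraph-isPartialInjOfSize s₀ k′ sN≤L L<n
  structure-isPartialInjOfSize (suc (suc (suc j))) = graph-isPartialInjOfSize into (<⇒≤ L<n)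
    (λ _ _ → extendById-injective (s * N) (digitSwap (toℕ j)) (λ {c} _ → digitSwap-< (toℕ j) c) (digitSwap-injective (toℕ<n j)))
    where
      into : MapsInto L n (extendById (s * N) (digitSwap (toℕ j)))
      into a<L = <-trans (extendById-into (s * N) (digitSwap (toℕ j)) (λ {c} _ → digitSwap-< (toℕ j) c)
                           (digitSwap-injective (toℕ<n j)) sN≤L a<L) L<n

  module _ (w : Vec (Fin n) k) where

    R⇒Φ : R w ≡ true → Sat n L (Φ k′) (lookup w) structure
    R⇒Φ Rw = codeF , Mark.markGraph-loop⇐ L isCode L<n code<L isCode-code ,
             Equivalence.from (Sat-⋀ k′ (DigitMatches k′)) matches
      where
        w<s : ∀ j → toℕ (lookup w j) < s
        w<s = R-digits w Rw
        code : ℕ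
        code = encode (digitsOf w) k
        code<sN : code < s * N
        code<sN = encode-< k (digitsOf-< (s≤s z≤n) w w<s)
        code<n : code < n
        code<n = <-trans (<-≤-trans code<sN sN≤L) L<n
        codeF : Fin n
        codeF = fromℕ< code<n
        codeF≡ : toℕ codeF ≡ code
        codeF≡ = toℕ-fromℕ< code<n
        code<L : toℕ codeF < L
        code<L = subst (_< L) (sym codeF≡) (<-≤-trans code<sN sN≤L)
        digit-code : ∀ j → digit code (toℕ j) ≡ toℕ (lookup w j)
        digit-code j = trans (digit-encode k (digitsOf-< (s≤s z≤n) w w<s) (toℕ<n j)) (digitsOf-lookup w j)
        isCode-code : isCode (toℕ codeF) ≡ true
        isCode-code = subst (λ c → isCode c ≡ true) (sym codeF≡)
          (×⇒∧≡true (<⇒<ᵇ≡true code<sN) (subst (λ u → R u ≡ true) (sym (decode-digits digit-code)) Rw))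
        matches : ∀ j → Sat n L (DigitMatches k′ j) (extend codeF (lookup w)) structure
        matches j = Mark.markGraph-loop⇐ L isDigit L<n (<-≤-trans (w<s j) s≤L) (<⇒<ᵇ≡true (w<s j)) ,
                    swappedF , ⇒graph code<L swappedF↤code ,
                    Equivalence.from (Sat-LowDigit s₀ k′ sN≤L L<n (suc (suc zero)) zero (suc (suc j)) refl
                                        (subst (_< s * N) (sym swappedF≡) swapped<sN) (w<s j))
                      (trans (cong (_% s) swappedF≡) (trans (digitSwap%s code (toℕ<n j)) (digit-code j)))
          where
            swapped<sN : digitSwap (toℕ j) code < s * N
            swapped<sN = digitSwap-< (toℕ j) code
            swapped<n : digitSwap (toℕ j) code < n
            swapped<n = <-trans (<-≤-trans swapped<sN sN≤L) L<n
            swappedF : Fin n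
            swappedF = fromℕ< swapped<n
            swappedF≡ : toℕ swappedF ≡ digitSwap (toℕ j) code
            swappedF≡ = toℕ-fromℕ< swapped<n
            swappedF↤code : toℕ swappedF ≡ extendById (s * N) (digitSwap (toℕ j)) (toℕ codeF)
            swappedF↤code = trans swappedF≡ (sym (trans (cong (extendById (s * N) (digitSwap (toℕ j))) codeF≡)
                              (extendById-< (s * N) (digitSwap (toℕ j)) code<sN)))

    Φ⇒R : Sat n L (Φ k′) (lookup w) structure → R w ≡ true
    Φ⇒R (c , c-code , matches) = subst (λ u → R u ≡ true) (decode-digits digits≡) R-decode
      where
        isCode-c : isCode (toℕ c) ≡ true
        isCode-c = proj₂ (Mark.markGraph-loop⇒ L isCode L<n c-code)
        c<sN : toℕ c < s * N
        c<sN = <ᵇ≡true⇒< (proj₁ (∧≡true⇒× isCode-c))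
        R-decode : R (decode (toℕ c)) ≡ true
        R-decode = proj₂ (∧≡true⇒× isCode-c)
        digits≡ : ∀ j → digit (toℕ c) (toℕ j) ≡ toℕ (lookup w j)
        digits≡ j with Equivalence.to (Sat-⋀ k′ (DigitMatches k′)) matches j
        ... | wj-digit , d , c↦d , low-digit = begin
          digit (toℕ c) (toℕ j)            ≡⟨ digitSwap%s (toℕ c) (toℕ<n j) ⟨
          digitSwap (toℕ j) (toℕ c) % s    ≡⟨ cong (_% s) d≡ ⟨
          toℕ d % s                        ≡⟨ Equivalence.to (Sat-LowDigit s₀ k′ sN≤L L<n (suc (suc zero)) zero (suc (suc j)) refl d<sN wj<s) low-digit ⟩
          toℕ (lookup w j)                 ∎
          where
            open ≡-Reasoning
            d≡ : toℕ d ≡ digitSwap (toℕ j) (toℕ c)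
            d≡ = trans (proj₂ (graph⇒ c↦d)) (extendById-< (s * N) (digitSwap (toℕ j)) c<sN)
            d<sN : toℕ d < s * N
            d<sN = subst (_< s * N) (sym d≡) (digitSwap-< (toℕ j) (toℕ c))
            wj<s : toℕ (lookup w j) < s
            wj<s = <ᵇ≡true⇒< (proj₂ (Mark.markGraph-loop⇒ L isDigit L<n wj-digit))

  Φ-expresses : Expresses n L (Φ k′) R
  Φ-expresses = structure , structure-isPartialInjOfSize , λ w → mk⇔ (R⇒Φ w) (Φ⇒R w)

Φ-expresses-empty : ∀ {n} k′ {R : RelK n (suc k′)} → (∀ w → R w ≢ true) → Expresses n 0 (Φ k′) R
Φ-expresses-empty {n} k′ R-empty =
    (λ _ → graph n 0 (λ c → c))
  , (λ _ → graph-isPartialInjOfSize (λ ()) z≤n (λ ()))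
  , λ w → mk⇔ (⊥-elim ∘ R-empty w) (λ (c , c-loop , _) → ⊥-elim (n≮0 (proj₁ (graph⇒ c-loop))))

Expresses-transport : ∀ {n L k m} {φ : Formula k m} {R R′ : RelK n k} (ψ : Permutation′ n) →
                      (∀ v → R′ v ≡ R (map (ψ ⟨$⟩ʳ_) v)) → Expresses n L φ R → Expresses n L φ R′
Expresses-transport {n} {L} {m = m} {φ = φ} {R} {R′} ψ R′≡ (S , S-inj , S-expresses) =
  pulled , (λ j → isPartialInjOfSize-pullback ψ (λ _ _ → refl) (S-inj j)) , λ v →
    ⇔-trans (mk⇔ (trans (sym (R′≡ v))) (trans (R′≡ v)))
   (⇔-trans (S-expresses (map (ψ ⟨$⟩ʳ_) v))
            (⇔-sym (Sat-transport ψ φ (λ x → lookup-map x (ψ ⟨$⟩ʳ_) v) (λ _ _ _ → refl))))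
  where
    open Transport L
    pulled : Fin m → Rel₂ n
    pulled j a b = S j (ψ ⟨$⟩ʳ a) (ψ ⟨$⟩ʳ b)

private
  digits-bound : ∀ {a k L} → a ^ k ≤ L → 0 < L → suc (pred a) ^ k ≤ L
  digits-bound {zero}  {k} _     0<L = subst (_≤ _) (sym (^-zeroˡ k)) 0<L
  digits-bound {suc a} a^k≤L _   = a^k≤L

map-inverseˡ : ∀ {n k} (π : Permutation′ n) (w : Vec (Fin n) k) → map (π ⟨$⟩ʳ_) (map (π ⟨$⟩ˡ_) w) ≡ w
map-inverseˡ π w = trans (sym (map-∘ (π ⟨$⟩ʳ_) (π ⟨$⟩ˡ_) w)) (trans (map-cong (Inverse.strictlyInverseˡ π) w) (map-id w))

IsoRel⇒≡∘map : ∀ {n k} {R′ R : RelK n k} → ((π , _) : IsoRel n k R′ R) → ∀ w → R′ w ≡ R (map (π ⟨$⟩ˡ_) w)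
IsoRel⇒≡∘map {R′ = R′} (π , R′∘π≡R) w = trans (cong R′ (sym (map-inverseˡ π w))) (R′∘π≡R (map (π ⟨$⟩ˡ_) w))

Φ-expresses-iso : ∀ {n L} k′ (A : Subset n) (R R′ : RelK n (suc k′)) → L < n → ∣ A ∣ ^ suc k′ ≤ L →
                  (∀ v → R v ≡ true → All (_∈ A) v) → IsoRel n (suc k′) R′ R → Expresses n L (Φ k′) R′
Φ-expresses-iso {n} {zero} k′ A R R′ _ |A|^k≤0 R⊆A R′≅R = Φ-expresses-empty k′ R′-empty
  where
    R′-empty : ∀ w → R′ w ≢ true
    R′-empty w R′w = <⇒≱ (m^n>0 ∣ A ∣ {{>-nonZero (≤-<-trans z≤n (x∈p⇒∣p-x∣<∣p∣ a∈A))}} (suc k′)) |A|^k≤0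
      where
        a∈A : lookup (map (proj₁ R′≅R ⟨$⟩ˡ_) w) zero ∈ A
        a∈A = lookup⁺ (R⊆A _ (trans (sym (IsoRel⇒≡∘map R′≅R w)) R′w)) zero
Φ-expresses-iso {n} {suc L} k′ A R R′ L<n |A|^k≤L R⊆A R′≅R =
  Expresses-transport {φ = Φ k′} ψ R′≡R₀∘ψ
    (Canonical.Φ-expresses (pred ∣ A ∣) k′ (digits-bound {∣ A ∣} {suc k′} |A|^k≤L (s≤s z≤n)) L<n R₀ R₀-digits)
  where
    ρ π ψ : Permutation′ n
    ρ = proj₁ (frontPermutation A)
    π = proj₁ R′≅R
    ψ = flip π ∘ₚ ρ

    R₀ : RelK n (suc k′)
    R₀ w = R (map (ρ ⟨$⟩ˡ_) w)

    R₀-digits : ∀ w → R₀ w ≡ true → ∀ j → toℕ (lookup w j) < suc (pred ∣ A ∣)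
    R₀-digits w R₀w j = s≤s (suc[m]≤n⇒m≤pred[n] (subst (λ a → toℕ a < ∣ A ∣) (Inverse.strictlyInverseˡ ρ (lookup w j))
      (proj₂ (frontPermutation A) (subst (_∈ A) (lookup-map j (ρ ⟨$⟩ˡ_) w) (lookup⁺ (R⊆A _ R₀w) j)))))

    R′≡R₀∘ψ : ∀ v → R′ v ≡ R₀ (map (ψ ⟨$⟩ʳ_) v)
    R′≡R₀∘ψ v = trans (IsoRel⇒≡∘map R′≅R v) (cong R (sym (trans (sym (map-∘ (ρ ⟨$⟩ˡ_) (ψ ⟨$⟩ʳ_) v))
                  (map-cong (λ x → Inverse.strictlyInverseʳ ρ (π ⟨$⟩ˡ x)) v))))

claim3p7 : (I : Set) (N : I → ℕ) (lam lam₁ : I → ℕ) (k : ℕ) → 1 ≤ k →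
           (A : (i : I) → Subset (N i)) (R : (i : I) → RelK (N i) k) →
           (∀ i → lam₁ i < N i) → (∀ i → lam i ^ k ≤ lam₁ i) →
           (∀ i → ∣ A i ∣ ≤ lam i) →
           (∀ i v → R i v ≡ true → All (λ a → a ∈ A i) v) →
           ExpressibleQ11 I N lam₁ k R
claim3p7 I N lam lam₁ (suc k′) _ A R λ₁<N λ^k≤λ₁ |A|≤λ R⊆A =
  3 + suc k′ , Φ k′ , λ i R′ R′≅R → Φ-expresses-iso k′ (A i) (R i) R′ (λ₁<N i)
    (≤-trans (^-monoˡ-≤ (suc k′) (|A|≤λ i)) (λ^k≤λ₁ i)) (R⊆A i) R′≅R
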